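{- Let $G$ and $H$ be two connected graphs of orders $n$ and $m\neq 1$, respectively, with $\gamma_{sp}(H)<m-1$ or $H=K_m$. Then $\gamma_{sp}(G\star H)=n(\gamma_{sp}(H)+1)$.
   Context: All graphs are finite, simple, undirected. $K_m$ is the complete graph on $m$ vertices. For $S\subseteq V(G)$, $\overline{S}=V(G)\setminus S$ and $N(v)$ denotes the open neighbourhood of $v$. A set $S$ is a super dominating set of $G$ if every vertex of $\overline{S}$ has a neighbour in $S$ and for every $u\in\overline{S}$ there is $v\in S$ with $N(v)\cap\overline{S}=\{u\}$. The super domination number $\gamma_{sp}(G)$ is the minimum cardinality of a super dominating set of $G$. The neighbourhood corona product $G\star H$ is the graph obtained by taking one copy of $G$ and $|V(G)|$ disjoint copies of $H$, one copy $H_w$ for each vertex $w$ of $G$, and joining every neighbour (in $G$) of $w$ to every vertex of $H_w$, for each $w\in V(G)$. -}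

module Defs where

open import Data.Nat using (ℕ; zero; suc; _+_; _*_; _≤_)
open import Data.Empty using (⊥-elim)
open import Data.Bool using (Bool; true; false; _∧_)
open import Data.Fin using (Fin; splitAt; remQuot; _≟_)
open import Data.Fin.Subset using (Subset; _∈_; _∉_; ∣_∣)
open import Data.Sum using (_⊎_; inj₁; inj₂)
open import Data.Product using (Σ; _×_; _,_; ∃)
open import Relation.Nullary using (¬_; does; yes; no)
open import Relation.Binary.PropositionalEquality using (_≡_; refl; sym; cong)

record Graph (n : ℕ) : Set where
  field
    Adj    : Fin n → Fin n → Bool
    adj-sym    : ∀ i j → Adj i j ≡ Adj j i
    adj-irrefl : ∀ i → Adj i i ≡ false
open Graph public

data Reachable {n : ℕ} (G : Graph n) : Fin n → Fin n → Set where
  here : ∀ {i} → Reachable G i i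
  step : ∀ {i j k} → Adj G i j ≡ true → Reachable G j k → Reachable G i k

Connected : ∀ {n} → Graph n → Set
Connected G = ∀ i j → Reachable G i j

IsComplete : ∀ {m} → Graph m → Set
IsComplete G = ∀ i j → ¬ (i ≡ j) → Adj G i j ≡ true

IsSuperDominating : ∀ {n} → Graph n → Subset n → Set
IsSuperDominating G S =
  (∀ u → u ∉ S → ∃ λ v → v ∈ S × Adj G v u ≡ true)
  × (∀ u → u ∉ S → ∃ λ v → v ∈ S × Adj G v u ≡ true
                             × (∀ w → w ∉ S → Adj G v w ≡ true → w ≡ u))

IsSuperDomNumber : ∀ {n} → Graph n → ℕ → Set
IsSuperDomNumber G k =
  (∃ λ S → IsSuperDominating G S × ∣ S ∣ ≡ k)
  × (∀ S → IsSuperDominating G S → k ≤ ∣ S ∣)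

-- Neighbourhood corona product. Vertices Fin (n + n * m):
-- splitAt n gives inj₁ a (vertex a of G) or inj₂ x, and remQuot m x = (w , h)
-- is vertex h of the copy H_w.
private
  ≟-sym : ∀ {n} (a b : Fin n) → does (a ≟ b) ≡ does (b ≟ a)
  ≟-sym a b with a ≟ b | b ≟ a
  ... | yes _ | yes _ = refl
  ... | no _  | no _  = refl
  ... | yes p | no q  = ⊥-elim (q (sym p))
  ... | no p  | yes q = ⊥-elim (p (sym q))

  ≟-refl : ∀ {n} (a : Fin n) → does (a ≟ a) ≡ true
  ≟-refl a with a ≟ a
  ... | yes _ = refl
  ... | no p  = ⊥-elim (p refl)

coronaAdj' : ∀ {n m} → Graph n → Graph m →
             Fin n ⊎ (Fin n × Fin m) → Fin n ⊎ (Fin n × Fin m) → Bool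
coronaAdj' G H (inj₁ a) (inj₁ b) = Adj G a b
coronaAdj' G H (inj₁ a) (inj₂ (w , h)) = Adj G a w
coronaAdj' G H (inj₂ (w , h)) (inj₁ a) = Adj G w a
coronaAdj' G H (inj₂ (w , h)) (inj₂ (w' , h')) = does (w ≟ w') ∧ Adj H h h'

decode : ∀ n m → Fin (n + n * m) → Fin n ⊎ (Fin n × Fin m)
decode n m i with splitAt n i
... | inj₁ a = inj₁ a
... | inj₂ x = inj₂ (remQuot m x)

private
  coronaSym' : ∀ {n m} (G : Graph n) (H : Graph m) x y →
               coronaAdj' G H x y ≡ coronaAdj' G H y x
  coronaSym' G H (inj₁ a) (inj₁ b) = adj-sym G a b
  coronaSym' G H (inj₁ a) (inj₂ (w , h)) = adj-sym G a w
  coronaSym' G H (inj₂ (w , h)) (inj₁ a) = adj-sym G w a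
  coronaSym' G H (inj₂ (w , h)) (inj₂ (w' , h'))
    rewrite ≟-sym w w' | adj-sym H h h' = refl

  coronaIrr' : ∀ {n m} (G : Graph n) (H : Graph m) x → coronaAdj' G H x x ≡ false
  coronaIrr' G H (inj₁ a) = adj-irrefl G a
  coronaIrr' G H (inj₂ (w , h)) rewrite ≟-refl w = adj-irrefl H h

_⋆_ : ∀ {n m} → Graph n → Graph m → Graph (n + n * m)
_⋆_ {n} {m} G H = record
  { Adj    = λ i j → coronaAdj' G H (decode n m i) (decode n m j)
  ; adj-sym    = λ i j → coronaSym' G H (decode n m i) (decode n m j)
  ; adj-irrefl = λ i → coronaIrr' G H (decode n m i)
  }

-- Upper bound: V(G) together with a minimum super dominating set S_H of H in every copy H_w
-- has n (k + 1) vertices and super dominates G ⋆ H, since a vertex of H_w outside it is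
-- privately dominated inside H_w, every other neighbour of its dominator lying in V(G).
-- Lower bound: let S be super dominating in G ⋆ H. Its trace on each copy H_w is super
-- dominating in H (a vertex of G privately dominating a vertex of H_w forces the rest of H_w
-- into S), so it has at least k vertices. Give w the weight [w ∈ S] + |S ∩ H_w|; it is at
-- least k + 1 unless w ∉ S and H_w ⊈ S. Such a deficient w is privately dominated by a vertex
-- of some copy H_w′ with w′ ∈ S, and w′ has weight at least k + 2: either H_w′ ⊆ S and k < m,
-- or S misses exactly one vertex of H_w′, and this is where k < m − 1 or H = K_m is needed.
-- Distinct deficient vertices have distinct partners, so pairing them off shows that the
-- weights, which sum to |S|, average at least k + 1.

module Submission where

open import Defs
open import Level using (0ℓ)
open import Data.Nat using (ℕ; zero; suc; _+_; _*_; _∸_; _≤_; _<_; z≤n; s≤s)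
open import Data.Nat.Properties hiding (_≟_)
open import Data.Bool using (Bool; true; false)
open import Data.Fin using (Fin; zero; suc; _↑ˡ_; _↑ʳ_; combine; splitAt; fromℕ<; _≟_)
open import Data.Fin.Properties
  using (any?; splitAt-↑ˡ; splitAt-↑ʳ; splitAt⁻¹-↑ˡ; splitAt⁻¹-↑ʳ; remQuot-combine; combine-remQuot)
open import Data.Fin.Permutation using (Permutation′; permutation)
open import Data.Fin.Subset using (Subset; _∈_; _∉_; ∣_∣; ⊤; ∁; ⁅_⁆; _⊆_)
open import Data.Fin.Subset.Properties
  using (_∈?_; ∣⊤∣≡n; p⊆q⇒∣p∣≤∣q∣; x∉∁p⇒x∈p; x∉p⇒x∈∁p; x∈∁p⇒x∉p; x∈⁅x⁆; x∈⁅y⁆⇒x≡y; x≢y⇒x∉⁅y⁆;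
         ∣∁p∣≡n∸∣p∣; ∣⁅x⁆∣≡1)
open import Data.Vec using ([]; _∷_; lookup; tabulate)
open import Data.Vec.Properties using (lookup∘tabulate; []=⇒lookup; lookup⇒[]=)
open import Data.Sum using (_⊎_; inj₁; inj₂)
open import Data.Sum.Properties using (inj₁-injective; inj₂-injective)
open import Data.Product using (_×_; _,_; ∃; proj₁; proj₂)
open import Function using (_∘_; id)
open import Function.Bundles using (_⇔_; Equivalence; mk⇔)
open import Relation.Nullary using (¬_; Dec; yes; no; contradiction)
open import Relation.Nullary.Decidable using (_×-dec_; ¬?; dec-true; decidable-stable)
open import Relation.Unary using (Pred; Decidable)
open import Relation.Binary.PropositionalEquality
open import Algebra.Properties.CommutativeMonoid.Sum +-0-commutativeMonoid
  using (sum; ∑-distrib-+; sum-cong-≗; sum-permute)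

-- Finite sums

sum-mono : ∀ {n} {f g : Fin n → ℕ} → (∀ i → f i ≤ g i) → sum f ≤ sum g
sum-mono {zero}  f≤g = z≤n
sum-mono {suc n} f≤g = +-mono-≤ (f≤g zero) (sum-mono (f≤g ∘ suc))

sum-const : ∀ n c → sum {n} (λ _ → c) ≡ n * c
sum-const zero    c = refl
sum-const (suc n) c = cong (c +_) (sum-const n c)

sum-↑ : ∀ a b (f : Fin (a + b) → ℕ) →
        sum f ≡ sum (λ i → f (i ↑ˡ b)) + sum (λ j → f (a ↑ʳ j))
sum-↑ zero    b f = refl
sum-↑ (suc a) b f = trans (cong (f zero +_) (sum-↑ a b (f ∘ suc)))
                          (sym (+-assoc (f zero) _ _))

sum-combine : ∀ n m (f : Fin (n * m) → ℕ) →
              sum f ≡ sum (λ i → sum (λ j → f (combine {n} {m} i j)))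
sum-combine zero    m f = refl
sum-combine (suc n) m f = trans (sum-↑ m (n * m) f)
  (cong (sum (λ j → f (j ↑ˡ (n * m))) +_) (sum-combine n m (λ j → f (m ↑ʳ j))))

boolToℕ : Bool → ℕ
boolToℕ true  = 1
boolToℕ false = 0

∣∣≡sum : ∀ {n} (S : Subset n) → ∣ S ∣ ≡ sum (boolToℕ ∘ lookup S)
∣∣≡sum []          = refl
∣∣≡sum (true ∷ S)  = cong suc (∣∣≡sum S)
∣∣≡sum (false ∷ S) = ∣∣≡sum S

sum-≥-involution : ∀ {n} (f : Fin n → ℕ) (τ : Fin n → Fin n) → (∀ v → τ (τ v) ≡ v) →
                   ∀ c → (∀ v → c + c ≤ f v + f (τ v)) → n * c ≤ sum f
sum-≥-involution {n} f τ τ-involutive c pair≥ = ≮⇒≥ λ sum<nc →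
  <⇒≱ (+-mono-< sum<nc sum<nc) double≥
  where
  open ≤-Reasoning
  double≥ : n * c + n * c ≤ sum f + sum f
  double≥ = begin
    n * c + n * c              ≡⟨ *-distribˡ-+ n c c ⟨
    n * (c + c)                ≡⟨ sum-const n (c + c) ⟨
    sum {n} (λ _ → c + c)      ≤⟨ sum-mono pair≥ ⟩
    sum (λ v → f v + f (τ v))  ≡⟨ ∑-distrib-+ f (f ∘ τ) ⟩
    sum f + sum (f ∘ τ)        ≡⟨ cong (sum f +_) (sum-permute f τ-permutation) ⟨
    sum f + sum f              ∎
    where
    τ-permutation : Permutation′ n
    τ-permutation = permutation τ τ τ-involutive τ-involutive

module Matching {n} {P : Pred (Fin n) 0ℓ} (P? : Decidable P) (R : Fin n → Fin n → Set)
  (partner : ∀ w → P w → ∃ (R w))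
  (partner-¬P : ∀ {w w′} → R w w′ → ¬ P w′)
  (partner-injective : ∀ {w₁ w₂ w′} → R w₁ w′ → R w₂ w′ → w₁ ≡ w₂) where

  ψ : Fin n → Fin n
  ψ w with P? w
  ... | yes p = proj₁ (partner w p)
  ... | no _  = w

  R-ψ : ∀ {w} → P w → R w (ψ w)
  R-ψ {w} p with P? w
  ... | yes p′ = proj₂ (partner w p′)
  ... | no ¬p  = contradiction p ¬p

  τ : Fin n → Fin n
  τ v with P? v | any? (λ w → P? w ×-dec (ψ w ≟ v))
  ... | yes _ | _           = ψ v
  ... | no _  | yes (w , _) = w
  ... | no _  | no _        = v

  data Matched (v : Fin n) : Fin n → Set where
    forward  : P v → Matched v (ψ v)
    backward : ∀ {w} → ¬ P v → P w → ψ w ≡ v → Matched v w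
    fixed    : ¬ P v → (∀ w → P w → ψ w ≢ v) → Matched v v

  matched : ∀ v → Matched v (τ v)
  matched v with P? v | any? (λ w → P? w ×-dec (ψ w ≟ v))
  ... | yes p  | _                   = forward p
  ... | no ¬p  | yes (w , p , ψw≡v)  = backward ¬p p ψw≡v
  ... | no ¬p  | no ∄w               = fixed ¬p (λ w p ψw≡v → ∄w (w , p , ψw≡v))

  τ-involutive : ∀ v → τ (τ v) ≡ v
  τ-involutive v with τ v in τv≡ | matched v
  ... | _ | forward p with τ (ψ v) | matched (ψ v)
  ...   | _ | forward p′           = contradiction p′ (partner-¬P (R-ψ p))
  ...   | _ | backward _ p′ ψw≡ψv  = partner-injective (subst (R _) ψw≡ψv (R-ψ p′)) (R-ψ p)
  ...   | _ | fixed _ ∄w           = contradiction refl (∄w v p)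
  τ-involutive v | w | backward ¬p p ψw≡v with τ w | matched w
  ...   | _ | forward _      = ψw≡v
  ...   | _ | backward ¬p′ _ _ = contradiction p ¬p′
  ...   | _ | fixed ¬p′ _    = contradiction p ¬p′
  τ-involutive v | _ | fixed _ _ = τv≡

sum-≥-matching :
  ∀ {n} {P : Pred (Fin n) 0ℓ} (P? : Decidable P) (R : Fin n → Fin n → Set)
  (partner : ∀ w → P w → ∃ (R w))
  (partner-¬P : ∀ {w w′} → R w w′ → ¬ P w′)
  (partner-injective : ∀ {w₁ w₂ w′} → R w₁ w′ → R w₂ w′ → w₁ ≡ w₂)
  (c : ℕ) (f : Fin n → ℕ) →
  (∀ w → c ≤ f w) → (∀ w → ¬ P w → suc c ≤ f w) →
  (∀ {w w′} → R w w′ → 2 + c ≤ f w′) →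
  n * suc c ≤ sum f
sum-≥-matching P? R partner partner-¬P partner-injective c f c≤f ¬P⇒c<f partner-surplus =
  sum-≥-involution f τ τ-involutive (suc c) pair≥
  where
  open Matching P? R partner partner-¬P partner-injective
  pair≥ : ∀ v → suc c + suc c ≤ f v + f (τ v)
  pair≥ v with τ v | matched v
  ... | _ | forward p =
    subst (_≤ f v + f (ψ v)) (+-suc c (suc c)) (+-mono-≤ (c≤f v) (partner-surplus (R-ψ p)))
  ... | w | backward _ p ψw≡v =
    subst (_≤ f v + f w) (cong suc (sym (+-suc c c)))
      (+-mono-≤ (partner-surplus (subst (R w) ψw≡v (R-ψ p))) (c≤f w))
  ... | _ | fixed ¬p _ = +-mono-≤ (¬P⇒c<f v ¬p) (¬P⇒c<f v ¬p)

-- Super domination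

preimage : ∀ {k N} → (Fin k → Fin N) → Subset N → Subset k
preimage g S = tabulate (lookup S ∘ g)

∈⇔lookup≡true : ∀ {N} {S : Subset N} {i} → i ∈ S ⇔ lookup S i ≡ true
∈⇔lookup≡true {S = S} {i} = mk⇔ []=⇒lookup (lookup⇒[]= i S)

∈-tabulate : ∀ {N} {p : Fin N → Bool} {i} → i ∈ tabulate p ⇔ p i ≡ true
∈-tabulate {p = p} {i} = mk⇔
  (λ i∈ → trans (sym (lookup∘tabulate p i)) (Equivalence.to ∈⇔lookup≡true i∈))
  (λ pi → Equivalence.from ∈⇔lookup≡true (trans (lookup∘tabulate p i) pi))

∈-preimage : ∀ {k N} {g : Fin k → Fin N} {S : Subset N} {i} → i ∈ preimage g S ⇔ g i ∈ S
∈-preimage = mk⇔ (Equivalence.from ∈⇔lookup≡true ∘ Equivalence.to ∈-tabulate)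
                 (Equivalence.from ∈-tabulate ∘ Equivalence.to ∈⇔lookup≡true)

∣tabulate∣ : ∀ {N} (p : Fin N → Bool) → ∣ tabulate p ∣ ≡ sum (boolToℕ ∘ p)
∣tabulate∣ p = trans (∣∣≡sum (tabulate p)) (sum-cong-≗ (cong boolToℕ ∘ lookup∘tabulate p))

SuperDominates : ∀ {V : Set} → (V → V → Bool) → (V → Set) → Set
SuperDominates adj In =
  ∀ u → ¬ In u → ∃ λ v → In v × adj v u ≡ true × (∀ w → ¬ In w → adj v w ≡ true → w ≡ u)

superDominates⇒isSuperDominating : ∀ {n} (G : Graph n) {S : Subset n} →
  SuperDominates (Adj G) (_∈ S) → IsSuperDominating G S
superDominates⇒isSuperDominating G sd =
  (λ u u∉S → let v , v∈S , vu , _ = sd u u∉S in v , v∈S , vu) , sd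

superDominates-transport :
  ∀ {A B : Set} {adjA : A → A → Bool} {adjB : B → B → Bool} {InA : A → Set} {InB : B → Set}
  (f : A → B) (g : B → A) → (∀ b → f (g b) ≡ b) → (∀ a → g (f a) ≡ a) →
  (∀ a a′ → adjB (f a) (f a′) ≡ adjA a a′) → (∀ a → InA a ⇔ InB (f a)) →
  SuperDominates adjB InB → SuperDominates adjA InA
superDominates-transport {adjA = adjA} {adjB} {InA} {InB} f g f∘g g∘f adj-f In-f sd u u∉
  with sd (f u) (u∉ ∘ Equivalence.from (In-f u))
... | v , v∈ , vu , unique = g v , g[v]∈ , g[v]u , unique′
  where
  adjB-at : ∀ {b} a′ → adjB b (f a′) ≡ true → adjA (g b) a′ ≡ true
  adjB-at {b} a′ ba′ =
    trans (sym (adj-f (g b) a′)) (subst (λ b′ → adjB b′ (f a′) ≡ true) (sym (f∘g b)) ba′)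
  g[v]∈ : InA (g v)
  g[v]∈ = Equivalence.from (In-f (g v)) (subst InB (sym (f∘g v)) v∈)
  g[v]u : adjA (g v) u ≡ true
  g[v]u = adjB-at u vu
  unique′ : ∀ w → ¬ InA w → adjA (g v) w ≡ true → w ≡ u
  unique′ w w∉ g[v]w = trans (sym (g∘f w)) (trans (cong g fw≡fu) (g∘f u))
    where
    fw≡fu : f w ≡ f u
    fw≡fu = unique (f w) (w∉ ∘ Equivalence.from (In-f w))
                   (subst (λ b → adjB b (f w) ≡ true) (f∘g v) (trans (adj-f (g v) w) g[v]w))

adj⇒≢ : ∀ {m} (H : Graph m) {u v} → Adj H u v ≡ true → u ≢ v
adj⇒≢ H {u} uv refl with () ← trans (sym uv) (adj-irrefl H u)

connected⇒neighbour : ∀ {m} (H : Graph m) → Connected H → 2 ≤ m → ∀ u → ∃ λ v → Adj H u v ≡ true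
connected⇒neighbour {suc zero}    H _ (s≤s ()) u
connected⇒neighbour {suc (suc m)} H connected _ u = walk-start (connected u (other u)) (other≢ u)
  where
  other : Fin (suc (suc m)) → Fin (suc (suc m))
  other zero    = suc zero
  other (suc _) = zero
  other≢ : ∀ u → u ≢ other u
  other≢ zero    ()
  other≢ (suc _) ()
  walk-start : ∀ {v} → Reachable H u v → u ≢ v → ∃ λ v → Adj H u v ≡ true
  walk-start here         u≢u = contradiction refl u≢u
  walk-start (step uw _) _   = _ , uw

∁⁅⁆-superDominating : ∀ {m} (H : Graph m) → (∀ u → ∃ λ v → Adj H u v ≡ true) →
  ∀ h → IsSuperDominating H (∁ ⁅ h ⁆)
∁⁅⁆-superDominating H neighbour h = superDominates⇒isSuperDominating H witness
  where
  outside≡h : ∀ {u} → u ∉ ∁ ⁅ h ⁆ → u ≡ h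
  outside≡h = x∈⁅y⁆⇒x≡y h ∘ x∉∁p⇒x∈p
  witness : SuperDominates (Adj H) (_∈ ∁ ⁅ h ⁆)
  witness u u∉ with outside≡h u∉
  ... | refl = let v , uv = neighbour u in
    v , x∉p⇒x∈∁p (x≢y⇒x∉⁅y⁆ λ v≡u → adj⇒≢ H uv (sym v≡u)) , trans (adj-sym H v u) uv ,
    λ w w∉ _ → outside≡h w∉

superDomNumber<order : ∀ {m} (H : Graph m) {k} → (∀ u → ∃ λ v → Adj H u v ≡ true) →
  IsSuperDomNumber H k → Fin m → k < m
superDomNumber<order {suc m} H {k} neighbour (_ , minimal) h =
  s≤s (subst (k ≤_) ∣∁⁅h⁆∣≡m (minimal _ (∁⁅⁆-superDominating H neighbour h)))
  where
  ∣∁⁅h⁆∣≡m : ∣ ∁ ⁅ h ⁆ ∣ ≡ m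
  ∣∁⁅h⁆∣≡m = trans (∣∁p∣≡n∸∣p∣ ⁅ h ⁆) (cong (suc m ∸_) (∣⁅x⁆∣≡1 h))

-- The neighbourhood corona

Vertex : ℕ → ℕ → Set
Vertex n m = Fin n ⊎ (Fin n × Fin m)

encode : ∀ n m → Vertex n m → Fin (n + n * m)
encode n m (inj₁ a)       = a ↑ˡ (n * m)
encode n m (inj₂ (w , h)) = n ↑ʳ combine w h

decode∘encode : ∀ n m x → decode n m (encode n m x) ≡ x
decode∘encode n m (inj₁ a) rewrite splitAt-↑ˡ n a (n * m) = refl
decode∘encode n m (inj₂ (w , h))
  rewrite splitAt-↑ʳ n (n * m) (combine w h) | remQuot-combine {n} {m} w h = refl

encode∘decode : ∀ n m i → encode n m (decode n m i) ≡ i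
encode∘decode n m i with splitAt n i in eq
... | inj₁ a = splitAt⁻¹-↑ˡ eq
... | inj₂ x = trans (cong (n ↑ʳ_) (combine-remQuot {n} m x)) (splitAt⁻¹-↑ʳ eq)

sum-corona : ∀ n m (g : Fin (n + n * m) → ℕ) →
  sum g ≡ sum (λ w → g (encode n m (inj₁ w)) + sum (λ h → g (encode n m (inj₂ (w , h)))))
sum-corona n m g = trans (sum-↑ n (n * m) g)
  (trans (cong (sum (λ w → g (w ↑ˡ (n * m))) +_) (sum-combine n m (λ j → g (n ↑ʳ j))))
         (sym (∑-distrib-+ (λ w → g (w ↑ˡ (n * m))) (λ w → sum (λ h → g (n ↑ʳ combine w h))))))

module _ {n m} (G : Graph n) (H : Graph m) where

  coronaAdj-copy : ∀ w h h′ → coronaAdj' G H (inj₂ (w , h)) (inj₂ (w , h′)) ≡ Adj H h h′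
  coronaAdj-copy w h h′ rewrite dec-true (w ≟ w) refl = refl

  coronaAdj-copy⁻ : ∀ w w′ {h h′} → coronaAdj' G H (inj₂ (w , h)) (inj₂ (w′ , h′)) ≡ true →
                    w ≡ w′ × Adj H h h′ ≡ true
  coronaAdj-copy⁻ w w′ adj with w ≟ w′
  ... | yes w≡w′ = w≡w′ , adj

  superDominates-vertices : ∀ {S : Subset (n + n * m)} →
    SuperDominates (Adj (G ⋆ H)) (_∈ S) → SuperDominates (coronaAdj' G H) (λ x → encode n m x ∈ S)
  superDominates-vertices = superDominates-transport (encode n m) (decode n m)
    (encode∘decode n m) (decode∘encode n m)
    (λ x y → cong₂ (coronaAdj' G H) (decode∘encode n m x) (decode∘encode n m y))
    (λ _ → mk⇔ id id)

liftᵇ : ∀ {n m} → Subset m → Vertex n m → Bool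
liftᵇ SH (inj₁ _)       = true
liftᵇ SH (inj₂ (_ , h)) = lookup SH h

lift : ∀ {n m} → Subset m → Subset (n + n * m)
lift {n} {m} SH = tabulate (liftᵇ SH ∘ decode n m)

module _ {n m} (G : Graph n) (H : Graph m) (SH : Subset m) where

  lift-superDominates : SuperDominates (Adj H) (_∈ SH) →
    SuperDominates (coronaAdj' G H) (λ x → liftᵇ SH x ≡ true)
  lift-superDominates sdH (inj₁ _) ∉lift = contradiction refl ∉lift
  lift-superDominates sdH (inj₂ (w , h)) ∉lift
    with sdH h (∉lift ∘ Equivalence.to ∈⇔lookup≡true)
  ... | v , v∈ , vh , unique =
    inj₂ (w , v) , Equivalence.to ∈⇔lookup≡true v∈ , trans (coronaAdj-copy G H w v h) vh , unique′
    where
    unique′ : ∀ z → liftᵇ SH z ≢ true → coronaAdj' G H (inj₂ (w , v)) z ≡ true → z ≡ inj₂ (w , h)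
    unique′ (inj₁ _) ∉lift _ = contradiction refl ∉lift
    unique′ (inj₂ (w′ , t)) ∉lift adj with coronaAdj-copy⁻ G H w w′ adj
    ... | refl , vt = cong (λ t → inj₂ (w , t)) (unique t (∉lift ∘ Equivalence.to ∈⇔lookup≡true) vt)

  lift-superDominating : IsSuperDominating H SH → IsSuperDominating (G ⋆ H) (lift {n} SH)
  lift-superDominating (_ , sdH) = superDominates⇒isSuperDominating (G ⋆ H)
    (superDominates-transport (decode n m) (encode n m) (decode∘encode n m) (encode∘decode n m)
      (λ _ _ → refl) (λ _ → ∈-tabulate) (lift-superDominates sdH))

  ∣lift∣ : ∣ lift {n} SH ∣ ≡ n * (∣ SH ∣ + 1)
  ∣lift∣ = begin
    ∣ lift {n} SH ∣                              ≡⟨ ∣tabulate∣ (liftᵇ SH ∘ decode n m) ⟩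
    sum (boolToℕ ∘ liftᵇ SH ∘ decode n m)        ≡⟨ sum-corona n m _ ⟩
    sum (λ w → count (inj₁ w) + sum (λ h → count (inj₂ (w , h))))
      ≡⟨ sum-cong-≗ (λ w → cong₂ _+_ (decoded (inj₁ w)) (sum-cong-≗ (decoded ∘ inj₂ ∘ (w ,_)))) ⟩
    sum {n} (λ _ → 1 + sum (boolToℕ ∘ lookup SH)) ≡⟨ sum-const n _ ⟩
    n * (1 + sum (boolToℕ ∘ lookup SH))          ≡⟨ cong (λ c → n * (1 + c)) (∣∣≡sum SH) ⟨
    n * (1 + ∣ SH ∣)                             ≡⟨ cong (n *_) (+-comm 1 ∣ SH ∣) ⟩
    n * (∣ SH ∣ + 1)                             ∎
    where
    open ≡-Reasoning
    count : Vertex n m → ℕ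
    count = boolToℕ ∘ liftᵇ SH ∘ decode n m ∘ encode n m
    decoded : ∀ x → count x ≡ boolToℕ (liftᵇ SH x)
    decoded x = cong (boolToℕ ∘ liftᵇ SH) (decode∘encode n m x)

module LowerBound {n m} (G : Graph n) (H : Graph m) {k : ℕ}
  (neighbour : ∀ u → ∃ λ v → Adj H u v ≡ true)
  (γ-H : IsSuperDomNumber H k) (k<m : k < m) (k<m∸1-or-complete : k < m ∸ 1 ⊎ IsComplete H)
  (S : Subset (n + n * m)) (sd : SuperDominates (coronaAdj' G H) (λ x → encode n m x ∈ S)) where

  In : Vertex n m → Set
  In x = encode n m x ∈ S

  copy : Fin n → Subset m
  copy w = preimage (encode n m ∘ inj₂ ∘ (w ,_)) S

  ∈copy : ∀ {w h} → In (inj₂ (w , h)) → h ∈ copy w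
  ∈copy = Equivalence.from ∈-preimage

  ∉copy : ∀ {w h} → h ∉ copy w → ¬ In (inj₂ (w , h))
  ∉copy h∉ = h∉ ∘ ∈copy

  weight : Fin n → ℕ
  weight w = boolToℕ (lookup S (encode n m (inj₁ w))) + ∣ copy w ∣

  ∣S∣≡sum-weight : ∣ S ∣ ≡ sum weight
  ∣S∣≡sum-weight = begin
    ∣ S ∣                        ≡⟨ ∣∣≡sum S ⟩
    sum (boolToℕ ∘ lookup S)     ≡⟨ sum-corona n m _ ⟩
    sum (λ w → boolToℕ (lookup S (encode n m (inj₁ w)))
             + sum (λ h → boolToℕ (lookup S (encode n m (inj₂ (w , h))))))
      ≡⟨ sum-cong-≗ (λ w → cong₂ _+_ refl (∣copy∣≡sum w)) ⟨
    sum weight                   ∎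
    where
    open ≡-Reasoning
    ∣copy∣≡sum : ∀ w → ∣ copy w ∣ ≡ sum (boolToℕ ∘ lookup S ∘ encode n m ∘ inj₂ ∘ (w ,_))
    ∣copy∣≡sum w = ∣tabulate∣ (lookup S ∘ encode n m ∘ inj₂ ∘ (w ,_))

  weight-inside : ∀ {w} → In (inj₁ w) → weight w ≡ suc ∣ copy w ∣
  weight-inside w∈ rewrite Equivalence.to ∈⇔lookup≡true w∈ = refl

  full-copy : ∀ {w} → ¬ (∃ λ h → h ∉ copy w) → m ≤ ∣ copy w ∣
  full-copy {w} ∄h = subst (_≤ ∣ copy w ∣) (∣⊤∣≡n m) (p⊆q⇒∣p∣≤∣q∣ {p = ⊤} ⊤⊆copy)
    where
    ⊤⊆copy : ⊤ ⊆ copy w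
    ⊤⊆copy {h} _ = decidable-stable (h ∈? copy w) (λ h∉ → ∄h (h , h∉))

  nearly-full-copy : ∀ {w h} → (∀ t → t ∉ copy w → t ≡ h) → m ∸ 1 ≤ ∣ copy w ∣
  nearly-full-copy {w} {h} only-h = subst (_≤ ∣ copy w ∣) ∣∁⁅h⁆∣≡m∸1 (p⊆q⇒∣p∣≤∣q∣ ∁⁅h⁆⊆)
    where
    ∣∁⁅h⁆∣≡m∸1 : ∣ ∁ ⁅ h ⁆ ∣ ≡ m ∸ 1
    ∣∁⁅h⁆∣≡m∸1 = trans (∣∁p∣≡n∸∣p∣ ⁅ h ⁆) (cong (m ∸_) (∣⁅x⁆∣≡1 h))
    ∁⁅h⁆⊆ : ∁ ⁅ h ⁆ ⊆ copy w
    ∁⁅h⁆⊆ {t} t∈ with t ∈? copy w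
    ... | yes t∈copy = t∈copy
    ... | no t∉copy  =
      contradiction (subst (_∈ ⁅ h ⁆) (sym (only-h t t∉copy)) (x∈⁅x⁆ h)) (x∈∁p⇒x∉p t∈)

  copy-index : ∀ {w w′ t u} → inj₂ {A = Fin n} {B = Fin n × Fin m} (w , t) ≡ inj₂ (w′ , u) → t ≡ u
  copy-index = cong proj₂ ∘ inj₂-injective

  copy-superDominates : ∀ w → SuperDominates (Adj H) (_∈ copy w)
  copy-superDominates w u u∉ with sd (inj₂ (w , u)) (∉copy u∉)
  ... | inj₂ (w′ , v) , v∈ , vu , unique with coronaAdj-copy⁻ G H w′ w vu
  ...   | refl , vu′ = v , ∈copy v∈ , vu′ , λ t t∉ vt →
    copy-index (unique _ (∉copy t∉) (trans (coronaAdj-copy G H w v t) vt))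
  copy-superDominates w u u∉ | inj₁ a , _ , au , unique with neighbour u
  ...   | v , uv =
    v , v∈ , trans (adj-sym H v u) uv , λ t t∉ _ → copy-index (unique _ (∉copy t∉) au)
    where
    v∈ : v ∈ copy w
    v∈ with v ∈? copy w
    ... | yes v∈ = v∈
    ... | no v∉  = contradiction (sym (copy-index (unique _ (∉copy v∉) au))) (adj⇒≢ H uv)

  k≤∣copy∣ : ∀ w → k ≤ ∣ copy w ∣
  k≤∣copy∣ w = proj₂ γ-H (copy w) (superDominates⇒isSuperDominating H (copy-superDominates w))

  Deficient : Fin n → Set
  Deficient w = ¬ In (inj₁ w) × ∃ λ h → h ∉ copy w

  deficient? : ∀ w → Dec (Deficient w)
  deficient? w = ¬? (encode n m (inj₁ w) ∈? S) ×-dec any? (λ h → ¬? (h ∈? copy w))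

  neighbours-inside : ∀ {w w′ h} → ¬ In (inj₁ w) → h ∉ copy w → Adj G w w′ ≡ true → In (inj₁ w′)
  neighbours-inside {w} {w′} {h} w∉ h∉ ww′ with sd (inj₂ (w , h)) (∉copy h∉)
  ... | inj₁ a , _ , aw , unique = contradiction (unique (inj₁ w) w∉ aw) λ ()
  ... | inj₂ (w₁ , h₁) , _ , adj₁ , unique with coronaAdj-copy⁻ G H w₁ w adj₁
  ...   | refl , _ with encode n m (inj₁ w′) ∈? S
  ...     | yes w′∈ = w′∈
  ...     | no w′∉  = contradiction (unique (inj₁ w′) w′∉ ww′) λ ()

  copy-misses-at-most-one : ∀ {w w′ h} → ¬ In (inj₁ w) → Adj G w′ w ≡ true → h ∉ copy w′ →
                     ∀ t → t ∉ copy w′ → t ≡ h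
  copy-misses-at-most-one {w} {w′} {h} w∉ w′w h∉ with sd (inj₂ (w′ , h)) (∉copy h∉)
  ... | inj₁ a , _ , aw′ , unique = λ t t∉ → copy-index (unique _ (∉copy t∉) aw′)
  ... | inj₂ (w₁ , h₁) , _ , adj₁ , unique with coronaAdj-copy⁻ G H w₁ w′ adj₁
  ...   | refl , _ = contradiction (unique (inj₁ w) w∉ w′w) λ ()

  record Partner (w w′ : Fin n) : Set where
    field
      outside  : ¬ In (inj₁ w)
      inside   : In (inj₁ w′)
      adjacent : Adj G w′ w ≡ true
      sole     : ∀ w₂ → ¬ In (inj₁ w₂) → Adj G w′ w₂ ≡ true → w₂ ≡ w
      surplus  : suc k ≤ ∣ copy w′ ∣

  private-dominator-in-copy : ∀ {w} → Deficient w →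
    ∃ λ w′ → ∃ λ h′ → In (inj₂ (w′ , h′)) × Adj G w′ w ≡ true ×
      (∀ z → ¬ In z → coronaAdj' G H (inj₂ (w′ , h′)) z ≡ true → z ≡ inj₁ w)
  private-dominator-in-copy {w} (w∉ , h , h∉) with sd (inj₁ w) w∉
  ... | inj₁ a , _ , aw , unique = contradiction (unique (inj₂ (w , h)) (∉copy h∉) aw) λ ()
  ... | inj₂ (w′ , h′) , y∈ , w′w , unique = w′ , h′ , y∈ , w′w , unique

  deficient⇒partner : ∀ w → Deficient w → ∃ (Partner w)
  deficient⇒partner w deficient@(w∉ , h , h∉)
    with private-dominator-in-copy deficient
  ... | w′ , h′ , y∈ , w′w , unique = w′ , record
    { outside = w∉
    ; inside  = neighbours-inside w∉ h∉ (trans (adj-sym G w w′) w′w)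
    ; adjacent = w′w
    ; sole    = λ w₂ w₂∉ w′w₂ → inj₁-injective (unique (inj₁ w₂) w₂∉ w′w₂)
    ; surplus = surplus
    }
    where
    surplus : suc k ≤ ∣ copy w′ ∣
    surplus with any? (λ t → ¬? (t ∈? copy w′))
    ... | no ∄h = <-≤-trans k<m (full-copy ∄h)
    ... | yes (h₂ , h₂∉) = by-hypothesis k<m∸1-or-complete
      where
      by-hypothesis : k < m ∸ 1 ⊎ IsComplete H → suc k ≤ ∣ copy w′ ∣
      by-hypothesis (inj₁ k<m∸1) =
        <-≤-trans k<m∸1 (nearly-full-copy (copy-misses-at-most-one w∉ w′w h₂∉))
      by-hypothesis (inj₂ complete) = contradiction (unique (inj₂ (w′ , h₂)) (∉copy h₂∉) h′h₂) λ ()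
        where
        h′≢h₂ : h′ ≢ h₂
        h′≢h₂ h′≡h₂ = h₂∉ (subst (_∈ copy w′) h′≡h₂ (∈copy y∈))
        h′h₂ : coronaAdj' G H (inj₂ (w′ , h′)) (inj₂ (w′ , h₂)) ≡ true
        h′h₂ = trans (coronaAdj-copy G H w′ h′ h₂) (complete h′ h₂ h′≢h₂)

  open Partner

  k≤weight : ∀ w → k ≤ weight w
  k≤weight w = ≤-trans (k≤∣copy∣ w) (m≤n+m _ _)

  nondeficient-weight : ∀ w → ¬ Deficient w → suc k ≤ weight w
  nondeficient-weight w ¬deficient with encode n m (inj₁ w) ∈? S
  ... | yes w∈ = subst (suc k ≤_) (sym (weight-inside w∈)) (s≤s (k≤∣copy∣ w))
  ... | no w∉  = <-≤-trans k<m (≤-trans (full-copy (λ ∃h → ¬deficient (w∉ , ∃h))) (m≤n+m _ _))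

  partner-weight : ∀ {w w′} → Partner w w′ → 2 + k ≤ weight w′
  partner-weight p = subst (2 + k ≤_) (sym (weight-inside (inside p))) (s≤s (surplus p))

  lower-bound : n * suc k ≤ ∣ S ∣
  lower-bound = subst (n * suc k ≤_) (sym ∣S∣≡sum-weight)
    (sum-≥-matching deficient? Partner deficient⇒partner
      (λ p (w′∉ , _) → w′∉ (inside p))
      (λ p₁ p₂ → sym (sole p₁ _ (outside p₂) (adjacent p₂)))
      k weight k≤weight nondeficient-weight partner-weight)

corollary3p4 : ∀ {n m} (G : Graph n) (H : Graph m) (k : ℕ) →
    1 ≤ n → 2 ≤ m → Connected G → Connected H →
    IsSuperDomNumber H k → (k < m ∸ 1 ⊎ IsComplete H) →
    IsSuperDomNumber (G ⋆ H) (n * (k + 1))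
corollary3p4 {n} {m} G H k _ 2≤m _ connected-H γ-H@((SH , sdH , ∣SH∣≡k) , _) k<m∸1-or-complete =
  (lift {n} SH , lift-superDominating G H SH sdH , ∣lift∣≡n[k+1]) , lower-bound
  where
  neighbour : ∀ u → ∃ λ v → Adj H u v ≡ true
  neighbour = connected⇒neighbour H connected-H 2≤m
  ∣lift∣≡n[k+1] : ∣ lift {n} SH ∣ ≡ n * (k + 1)
  ∣lift∣≡n[k+1] = trans (∣lift∣ G H SH) (cong (λ c → n * (c + 1)) ∣SH∣≡k)
  lower-bound : ∀ S → IsSuperDominating (G ⋆ H) S → n * (k + 1) ≤ ∣ S ∣
  lower-bound S (_ , sd) = subst (_≤ ∣ S ∣) (cong (n *_) (+-comm 1 k))
    (LowerBound.lower-bound G H neighbour γ-H (superDomNumber<order H neighbour γ-H (fromℕ< 2≤m))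
       k<m∸1-or-complete S (superDominates-vertices G H sd))
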